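{- Let $\epsilon=(\alpha,\beta,\gamma)$ be a one-face embedding of a graph $G$ (i.e. $\gamma=\alpha\beta$ is a single cycle), and let $\nu$ be a vertex of $G$ with $deg(\nu)\geq 4$. Then there exists at least one reembedding $\beta'\neq\beta$ of $\nu$ such that the resulting embedding $\epsilon'=(\alpha,\beta',\alpha\beta')$ has the same genus as $\epsilon$.
   Context: A map (embedding of a graph on a closed orientable surface) with $m$ edges is a triple $(\alpha,\beta,\gamma)$ of permutations of $[2m]$ (elements are half-edges) where $\alpha$ is a fixed-point-free involution whose cycles are the edges, the cycles of $\beta$ give the counterclockwise cyclic order of half-edges at each vertex, and $\gamma=\alpha\beta$ (composition), whose cycles are the faces. Its genus $g$ is defined by $C(\beta)-C(\alpha)+C(\gamma)=2-2g$, where $C(\cdot)$ is the number of cycles. The underlying graph is $G=(\alpha,Par_\beta)$, $Par_\beta$ being the partition of $[2m]$ into cycles of $\beta$; its blocks are the vertices, and $deg(\nu)=|\nu|$. An embedding of $G$ is any map $(\alpha,\beta',\alpha\beta')$ with $Par_{\beta'}=Par_\beta$. A reembedding of the vertex $\nu$ is a permutation $\beta'$ with $\beta'(x)=\beta(x)$ for $x\notin\nu$ and $\beta'$ restricted to $\nu$ a single cycle on $\nu$. -}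

module Defs where

open import Data.Nat using (ℕ; zero; suc; _+_; _*_)
open import Data.Fin using (Fin; toℕ; _≤_; _≟_)
open import Data.Fin.Properties using (all?; any?; _≤?_)
open import Data.Fin.Permutation using (Permutation′; _⟨$⟩ʳ_; _∘ₚ_)
open import Data.List using (List; length; filter)
open import Data.List using () renaming (tabulate to tab)
open import Data.Integer as ℤ using (ℤ; +_)
open import Data.Product using (Σ; ∃; _×_)
open import Relation.Binary.PropositionalEquality using (_≡_; _≢_)
open import Relation.Nullary using (Dec; ¬_)

allElems : (n : ℕ) → List (Fin n)
allElems n = tab (λ i → i)

iter : ∀ {n} → Permutation′ n → ℕ → Fin n → Fin n
iter π zero    x = x
iter π (suc k) x = π ⟨$⟩ʳ (iter π k x)

-- y lies in the cycle (orbit) of x under π.  For a permutation of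
-- n points every element of the orbit is reached in fewer than n steps.
InOrbit : ∀ {n} → Permutation′ n → Fin n → Fin n → Set
InOrbit {n} π x y = Σ (Fin n) λ k → iter π (toℕ k) x ≡ y

inOrbit? : ∀ {n} (π : Permutation′ n) (x y : Fin n) → Dec (InOrbit π x y)
inOrbit? {n} π x y = any? {n} (λ k → iter π (toℕ k) x ≟ y)

-- C(π): number of cycles of π (= number of cycles' minimal elements)
numCycles : ∀ {n} → Permutation′ n → ℕ
numCycles {n} π =
  length (filter (λ x → all? {n} (λ k → x ≤? iter π (toℕ k) x)) (allElems n))

deg : ∀ {n} → Permutation′ n → Fin n → ℕ
deg {n} β x = length (filter (inOrbit? β x) (allElems n))

-- face permutation γ = αβ  (apply β first, then α)
faces : ∀ {n} → Permutation′ n → Permutation′ n → Permutation′ n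
faces α β = β ∘ₚ α

FPFInvolution : ∀ {n} → Permutation′ n → Set
FPFInvolution {n} α =
  ((x : Fin n) → α ⟨$⟩ʳ (α ⟨$⟩ʳ x) ≡ x) × ((x : Fin n) → α ⟨$⟩ʳ x ≢ x)

HasGenus : ∀ {n} → Permutation′ n → Permutation′ n → ℕ → Set
HasGenus α β g =
  (+ numCycles β) ℤ.- (+ numCycles α) ℤ.+ (+ numCycles (faces α β))
    ≡ (+ 2) ℤ.- (+ (2 * g))

-- β' is a reembedding (w.r.t. β) of the vertex ν = cycle of β containing x:
-- β' agrees with β outside ν, and β' restricted to ν is a single cycle on ν.
Reembedding : ∀ {n} → Permutation′ n → Fin n → Permutation′ n → Set
Reembedding {n} β x β' =
  ((y : Fin n) → ¬ InOrbit β x y → β' ⟨$⟩ʳ y ≡ β ⟨$⟩ʳ y)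
  × ((y : Fin n) → InOrbit β x y → InOrbit β x (β' ⟨$⟩ʳ y))
  × ((y : Fin n) → InOrbit β x y → InOrbit β' x y)

module Submission where

-- The half-edges x, βx, β²x, β³x of ν are distinct and lie in this
-- cyclic order around ν.  Reading off their cyclic order along the single
-- face γ, either three of them, a b c, appear in the same cyclic order
-- around ν and along the face, or all four appear in opposite orders.  We
-- twist β by τ = (a b c), resp. τ = (a c)(b d): β' = β ∘ τ, so that also
-- γ' = αβ' = γ ∘ τ.  Walking along β (resp. γ) from one marked half-edge to
-- the next shows that in β' (resp. γ') every marked half-edge leads back to
-- a.  Hence ν stays a single cycle of β' while the other vertices are
-- untouched, and γ' is again a single face; the numbers of vertices and
-- faces, and with them the genus, do not change.

open import Defs
open import Data.Nat as ℕ using (ℕ; zero; suc; _+_; _∸_; _*_; _/_; _%_; _<_; _≤_; z≤n; s≤s; z<s)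
open import Data.Nat.Properties
open import Data.Nat.DivMod using (m≡m%n+[m/n]*n; m%n<n)
open import Data.Nat.Induction using (<-rec)
open import Data.Fin as Fin using (Fin; toℕ; fromℕ<)
import Data.Fin.Properties as FinP
open import Data.Fin.Permutation using (Permutation′; _⟨$⟩ʳ_; _⟨$⟩ˡ_; inverseˡ; _∘ₚ_; transpose)
import Data.Fin.Permutation.Components as PC
open import Data.List using (List; []; _∷_; length; filter; applyUpTo; map)
open import Data.List using () renaming (tabulate to tab)
open import Data.List.Properties using (filter-notAll; filter-accept; filter-none; filter-≐; length-applyUpTo)
open import Data.List.Membership.Propositional using (_∈_; _∉_)
open import Data.List.Membership.Propositional.Properties using (∈-filter⁺; ∈-filter⁻; ∈-tabulate⁺; ∈-applyUpTo⁺; ∈-map⁻)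
open import Data.List.Relation.Unary.Any using (Any; here; there)
import Data.List.Relation.Unary.Any as Any
open import Data.List.Relation.Unary.All using (All; []; _∷_)
import Data.List.Relation.Unary.All as All
open import Data.List.Relation.Unary.All.Properties using (tabulate⁺)
open import Data.List.Relation.Unary.Unique.Propositional using (Unique)
import Data.List.Relation.Unary.Unique.Propositional.Properties as Unique
open import Data.List.Relation.Unary.AllPairs using (_∷_)
open import Data.Integer as ℤ using (+_)
open import Data.Product using (Σ; ∃; _×_; _,_; proj₁; proj₂)
open import Data.Sum using (_⊎_; inj₁; inj₂; [_,_]′)
open import Data.Empty using (⊥-elim)
open import Function.Base using (_∘′_)
open import Function.Bundles using (_⇔_; mk⇔)
open import Relation.Nullary using (yes; no; ¬_; ¬?)
open import Relation.Nullary.Decidable using (_×-dec_)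
open import Relation.Unary using (Decidable)
open import Relation.Binary.PropositionalEquality
open import Relation.Binary.Definitions using (tri<; tri≈; tri>)

Least : (ℕ → Set) → ℕ → Set
Least P k = P k × (∀ {t} → t < k → ¬ P t)

leastWitness : ∀ {P : ℕ → Set} → Decidable P → ∀ K → P K → ∃ (Least P)
leastWitness {P} P? = <-rec (λ K → P K → ∃ (Least P)) search
  where
  search : ∀ K → (∀ {t} → t < K → P t → ∃ (Least P)) → P K → ∃ (Least P)
  search K smaller pK with anyUpTo? P? K
  ... | yes (t , t<K , pt) = smaller t<K pt
  ... | no none            = K , pK , λ t<K pt → none (_ , t<K , pt)

-- v lies on the σ-orbit of u.  Unlike InOrbit (from Defs) the number of
-- steps is an unbounded natural number, which makes composition easy.
Reach : ∀ {n} → Permutation′ n → Fin n → Fin n → Set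
Reach σ u v = ∃ λ k → iter σ k u ≡ v

module Orbits {n : ℕ} (σ : Permutation′ n) where

  injective : ∀ {u v} → σ ⟨$⟩ʳ u ≡ σ ⟨$⟩ʳ v → u ≡ v
  injective e = trans (sym (inverseˡ σ)) (trans (cong (σ ⟨$⟩ˡ_) e) (inverseˡ σ))

  iter-+ : ∀ a b u → iter σ (a + b) u ≡ iter σ a (iter σ b u)
  iter-+ zero    b u = refl
  iter-+ (suc a) b u = cong (σ ⟨$⟩ʳ_) (iter-+ a b u)

  iter-injective : ∀ k {u v} → iter σ k u ≡ iter σ k v → u ≡ v
  iter-injective zero    e = e
  iter-injective (suc k) e = iter-injective k (injective e)

  iter-return : ∀ i d u → iter σ i u ≡ iter σ (i + d) u → iter σ d u ≡ u
  iter-return i d u e = sym (iter-injective i (trans e (iter-+ i d u)))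

  Returns : Fin n → ℕ → Set
  Returns u k = 0 < k × iter σ k u ≡ u

  returns? : ∀ u → Decidable (Returns u)
  returns? u k = (0 <? k) ×-dec (iter σ k u Fin.≟ u)

  record Period (u : Fin n) : Set where
    field
      P       : ℕ
      P>0     : 0 < P
      return  : iter σ P u ≡ u
      minimal : ∀ {j} → 0 < j → j < P → iter σ j u ≢ u
      P≤n     : P ≤ n

  periodBelow : ∀ {u} d → d ≤ n → Returns u d → Period u
  periodBelow {u} d d≤n rd with leastWitness (returns? u) d rd
  ... | P , (P>0 , ret) , below = record
    { P = P ; P>0 = P>0 ; return = ret
    ; minimal = λ 0<j j<P r → below j<P (0<j , r)
    ; P≤n = ≤-trans (≮⇒≥ λ d<P → below d<P rd) d≤n }

  -- Among the n + 1 points u, σu, …, σⁿu two coincide (pigeonhole), which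
  -- gives a return time ≤ n.
  period : (u : Fin n) → Period u
  period u with FinP.pigeonhole (n<1+n n) (λ i → iter σ (toℕ i) u)
  ... | i , j , i<j , same = periodBelow (toℕ j ∸ toℕ i) j-i≤n
          (m<n⇒0<n∸m i<j , iter-return (toℕ i) _ u
             (trans same (cong (λ k → iter σ k u) (sym (m+[n∸m]≡n (<⇒≤ i<j))))))
    where
    j-i≤n : toℕ j ∸ toℕ i ≤ n
    j-i≤n = ≤-trans (m∸n≤m (toℕ j) (toℕ i)) (≤-pred (FinP.toℕ<n j))

  module Positions {u : Fin n} (p : Period u) where
    open Period p

    instance
      P-nonZero : ℕ.NonZero P
      P-nonZero = ℕ.>-nonZero P>0

    iter-multiple : ∀ q → iter σ (q * P) u ≡ u
    iter-multiple zero    = refl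
    iter-multiple (suc q) = begin
      iter σ (P + q * P) u       ≡⟨ iter-+ P (q * P) u ⟩
      iter σ P (iter σ (q * P) u) ≡⟨ cong (iter σ P) (iter-multiple q) ⟩
      iter σ P u                 ≡⟨ return ⟩
      u                          ∎
      where open ≡-Reasoning

    reduce : ∀ j → ∃ λ j' → j' < P × iter σ j u ≡ iter σ j' u
    reduce j = j % P , m%n<n j P , (begin
      iter σ j u                             ≡⟨ cong (λ k → iter σ k u) (m≡m%n+[m/n]*n j P) ⟩
      iter σ (j % P + j / P * P) u           ≡⟨ iter-+ (j % P) (j / P * P) u ⟩
      iter σ (j % P) (iter σ (j / P * P) u)  ≡⟨ cong (iter σ (j % P)) (iter-multiple (j / P)) ⟩
      iter σ (j % P) u                       ∎)
      where open ≡-Reasoning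

    no-repeat : ∀ {i j} → i < j → j < P → iter σ i u ≢ iter σ j u
    no-repeat {i} {j} i<j j<P e = minimal (m<n⇒0<n∸m i<j) (≤-<-trans (m∸n≤m j i) j<P)
      (iter-return i (j ∸ i) u (trans e (cong (λ k → iter σ k u) (sym (m+[n∸m]≡n (<⇒≤ i<j))))))

    position-injective : ∀ {i j} → i < P → j < P → iter σ i u ≡ iter σ j u → i ≡ j
    position-injective {i} {j} i<P j<P e with <-cmp i j
    ... | tri< i<j _ _ = ⊥-elim (no-repeat i<j j<P e)
    ... | tri≈ _ i≡j _ = i≡j
    ... | tri> _ _ j<i = ⊥-elim (no-repeat j<i i<P (sym e))

  reach-refl : ∀ {u} → Reach σ u u
  reach-refl = 0 , refl

  reach-step : ∀ {u} → Reach σ u (σ ⟨$⟩ʳ u)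
  reach-step = 1 , refl

  reach-trans : ∀ {u v w} → Reach σ u v → Reach σ v w → Reach σ u w
  reach-trans {u} (k , refl) (l , refl) = l + k , iter-+ l k u

  -- Going once more around the cycle of u returns from v to u.
  reach-sym : ∀ {u v} → Reach σ u v → Reach σ v u
  reach-sym {u} (k , refl) with Positions.reduce (period u) k
  ... | k' , k'<P , e = P ∸ k' , (begin
      iter σ (P ∸ k') (iter σ k u)   ≡⟨ cong (iter σ (P ∸ k')) e ⟩
      iter σ (P ∸ k') (iter σ k' u)  ≡⟨ iter-+ (P ∸ k') k' u ⟨
      iter σ (P ∸ k' + k') u         ≡⟨ cong (λ j → iter σ j u) (m∸n+n≡m (<⇒≤ k'<P)) ⟩
      iter σ P u                     ≡⟨ return ⟩
      u                              ∎)
    where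
    open Period (period u)
    open Positions (period u)
    open ≡-Reasoning

  reach⇒inOrbit : ∀ {u v} → Reach σ u v → InOrbit σ u v
  reach⇒inOrbit {u} (k , refl) with Positions.reduce (period u) k
  ... | k' , k'<P , e = fromℕ< k'<n ,
        trans (cong (λ j → iter σ j u) (FinP.toℕ-fromℕ< k'<n)) (sym e)
    where
    k'<n : k' < n
    k'<n = <-≤-trans k'<P (Period.P≤n (period u))

  inOrbit⇒reach : ∀ {u v} → InOrbit σ u v → Reach σ u v
  inOrbit⇒reach (k , e) = toℕ k , e

nonempty : ∀ {A : Set} {x : A} {xs} → x ∈ xs → 1 ≤ length xs
nonempty (here _)  = s≤s z≤n
nonempty (there _) = s≤s z≤n

two-members : ∀ {A : Set} {x y : A} {xs} → x ∈ xs → y ∈ xs → x ≢ y → 2 ≤ length xs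
two-members (here refl) (here refl) x≢y = ⊥-elim (x≢y refl)
two-members (here _)    (there q)   _   = s≤s (nonempty q)
two-members (there p)   (here _)    _   = s≤s (nonempty p)
two-members (there p)   (there q)   x≢y = ≤-trans (two-members p q x≢y) (n≤1+n _)

unique-⊆-length : ∀ {n} (xs L : List (Fin n)) → Unique xs → (∀ {y} → y ∈ xs → y ∈ L) →
                  length xs ≤ length L
unique-⊆-length []       L _            _   = z≤n
unique-⊆-length (x ∷ xs) L (x∉xs ∷ uniq) xs⊆L =
  ≤-trans (s≤s (unique-⊆-length xs L-x uniq xs⊆L-x)) (filter-notAll ≢x? L x∈L)
  where
  ≢x? = λ z → ¬? (x Fin.≟ z)
  L-x = filter ≢x? L
  xs⊆L-x : ∀ {y} → y ∈ xs → y ∈ L-x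
  xs⊆L-x y∈xs = ∈-filter⁺ ≢x? (xs⊆L (there y∈xs)) (All.lookup x∉xs y∈xs)
  x∈L : Any (λ z → ¬ ¬ x ≡ z) L
  x∈L = Any.map (λ x≡z x≢z → x≢z x≡z) (xs⊆L (here refl))

-- The degree of x (size of its β-cycle) is at most the period of x,
-- since the cycle is covered by x, βx, …, β^(P-1)x.
deg≤period : ∀ {n} (β : Permutation′ n) x → deg β x ≤ Orbits.Period.P (Orbits.period β x)
deg≤period {n} β x = begin
  deg β x          ≤⟨ unique-⊆-length cycle firstSteps unique-cycle cycle⊆firstSteps ⟩
  length firstSteps ≡⟨ length-applyUpTo (λ j → iter β j x) P ⟩
  P                ∎
  where
  open Orbits β
  open Period (period x)
  open Positions (period x)
  open ≤-Reasoning
  cycle = filter (inOrbit? β x) (allElems n)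
  firstSteps = applyUpTo (λ j → iter β j x) P
  unique-cycle : Unique cycle
  unique-cycle = Unique.filter⁺ (inOrbit? β x) (Unique.tabulate⁺ (λ e → e))
  cycle⊆firstSteps : ∀ {y} → y ∈ cycle → y ∈ firstSteps
  cycle⊆firstSteps y∈cycle with proj₂ (∈-filter⁻ (inOrbit? β x) {xs = allElems n} y∈cycle)
  ... | k , refl with reduce (toℕ k)
  ...   | k' , k'<P , e = subst (_∈ firstSteps) (sym e) (∈-applyUpTo⁺ (λ j → iter β j x) k'<P)

-- x is the smallest point of its σ-cycle.  numCycles σ counts exactly
-- these points, one per cycle.
IsCycleMin : ∀ {n} → Permutation′ n → Fin n → Set
IsCycleMin {n} σ x = ∀ (k : Fin n) → x Fin.≤ iter σ (toℕ k) x

isCycleMin? : ∀ {n} (σ : Permutation′ n) → Decidable (IsCycleMin σ)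
isCycleMin? {n} σ x = FinP.all? {n} (λ k → x FinP.≤? iter σ (toℕ k) x)

numCycles-cycleMins : ∀ {n} (σ : Permutation′ n) →
                      numCycles σ ≡ length (filter (isCycleMin? σ) (allElems n))
numCycles-cycleMins σ = refl

minimumWitness : ∀ {n} {Q : Fin n → Set} → Decidable Q → ∀ w → Q w →
                 ∃ λ m → Q m × (∀ z → Q z → m Fin.≤ z)
minimumWitness {suc n} {Q} Q? w qw with Q? Fin.zero
... | yes q0 = Fin.zero , q0 , λ _ _ → z≤n
minimumWitness {suc n} Q? Fin.zero    qw | no ¬q0 = ⊥-elim (¬q0 qw)
minimumWitness {suc n} Q? (Fin.suc w) qw | no ¬q0
  with minimumWitness (λ z → Q? (Fin.suc z)) w qw
... | m , qm , m-min = Fin.suc m , qm , λ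
  { Fin.zero q → ⊥-elim (¬q0 q)
  ; (Fin.suc z) q → s≤s (m-min z q) }

module CycleCount {n : ℕ} (σ : Permutation′ n) where
  open Orbits σ

  cycleMin : ∀ u → ∃ λ m → Reach σ u m × IsCycleMin σ m
  cycleMin u with minimumWitness (inOrbit? σ u) u (reach⇒inOrbit reach-refl)
  ... | m , u~m , m-min =
    m , inOrbit⇒reach u~m , λ k → m-min _ (reach⇒inOrbit (reach-trans (inOrbit⇒reach u~m) (toℕ k , refl)))

  twoCycleMins : ∀ {m m'} → IsCycleMin σ m → IsCycleMin σ m' → m ≢ m' → 2 ≤ numCycles σ
  twoCycleMins {m} {m'} min min' m≢m' = two-members {xs = filter (isCycleMin? σ) (allElems n)}
    (∈-filter⁺ (isCycleMin? σ) (∈-tabulate⁺ m) min)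
    (∈-filter⁺ (isCycleMin? σ) (∈-tabulate⁺ m') min') m≢m'

  oneCycle⇒transitive : numCycles σ ≡ 1 → ∀ u v → Reach σ u v
  oneCycle⇒transitive one u v = via (cycleMin u) (cycleMin v)
    where
    via : (∃ λ m → Reach σ u m × IsCycleMin σ m) → (∃ λ m → Reach σ v m × IsCycleMin σ m) → Reach σ u v
    via (m , u~m , min) (m' , v~m' , min') with m Fin.≟ m'
    ... | yes refl = reach-trans u~m (reach-sym v~m')
    ... | no m≢m'  = ⊥-elim (1+n≰n (subst (2 ≤_) one (twoCycleMins min min' m≢m')))

-- a transitive permutation of a nonempty set has a single cycle: only the
-- point 0 is the minimum of its cycle.
transitive⇒oneCycle : ∀ {n} (σ : Permutation′ n) → Fin n → (∀ u v → Reach σ u v) →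
                      numCycles σ ≡ 1
transitive⇒oneCycle {suc n} σ _ transitive = begin
  numCycles σ                               ≡⟨ numCycles-cycleMins σ ⟩
  length (filter min? (Fin.zero ∷ others))  ≡⟨ cong length (filter-accept min? {xs = others} 0-min) ⟩
  suc (length (filter min? others))         ≡⟨ cong (λ l → suc (length l)) (filter-none min? others-not-min) ⟩
  1                                         ∎
  where
  open ≡-Reasoning
  min? = isCycleMin? σ
  others : List (Fin (suc n))
  others = tab Fin.suc
  0-min : IsCycleMin σ Fin.zero
  0-min _ = z≤n
  not-min : ∀ i → ¬ IsCycleMin σ (Fin.suc i)
  not-min i i-min with Orbits.reach⇒inOrbit σ (transitive (Fin.suc i) Fin.zero)
  ... | k , reaches-0 = n≮0 (subst (λ z → Fin.suc i Fin.≤ z) reaches-0 (i-min k))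
  others-not-min : All (λ z → ¬ IsCycleMin σ z) others
  others-not-min = tabulate⁺ not-min

numCycles-cong : ∀ {n} (σ ρ : Permutation′ n) →
                 (∀ {y z} → Reach σ y z → Reach ρ y z) → (∀ {y z} → Reach ρ y z → Reach σ y z) →
                 numCycles σ ≡ numCycles ρ
numCycles-cong {n} σ ρ σ⊆ρ ρ⊆σ =
  cong length (filter-≐ (isCycleMin? σ) (isCycleMin? ρ) (min-transfer σ ρ ρ⊆σ , min-transfer ρ σ σ⊆ρ) (allElems n))
  where
  min-transfer : ∀ σ ρ → (∀ {y z} → Reach ρ y z → Reach σ y z) → ∀ {y} → IsCycleMin σ y → IsCycleMin ρ y
  min-transfer σ ρ ρ⊆σ {y} y-min k with Orbits.reach⇒inOrbit σ (ρ⊆σ (toℕ k , refl))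
  ... | k' , e = subst (y Fin.≤_) e (y-min k')

Seg : ∀ {n} → Permutation′ n → (Fin n → Set) → Fin n → Fin n → Set
Seg σ S u v = ∃ λ k → iter σ k u ≡ v × (∀ {t} → t < k → ¬ S (iter σ t u))

module Segments {n : ℕ} (σ : Permutation′ n) where
  open Orbits σ

  seg-weaken : ∀ {S S' : Fin n → Set} {u v} → (∀ y → S' y → S y) → Seg σ S u v → Seg σ S' u v
  seg-weaken S'⊆S (k , e , avoid) = k , e , λ t<k s' → avoid t<k (S'⊆S _ s')

  seg-join : ∀ {S S' : Fin n → Set} {u w v} → (∀ y → S' y → S y) →
             Seg σ S u w → ¬ S' w → Seg σ S (σ ⟨$⟩ʳ w) v → Seg σ S' u v
  seg-join {S} {S'} {u} {w} {v} S'⊆S (k , refl , avoid₁) w∉S' (l , refl , avoid₂) =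
    l + suc k , iter-+ l (suc k) u , avoid
    where
    avoid : ∀ {t} → t < l + suc k → ¬ S' (iter σ t u)
    avoid {t} t<l+k+1 with <-cmp t k
    ... | tri< t<k _ _ = λ s → avoid₁ t<k (S'⊆S _ s)
    ... | tri≈ _ refl _ = w∉S'
    ... | tri> _ _ k<t = λ s → avoid₂ t∸k-1<l (S'⊆S _ (subst S' t-shift s))
      where
      t≡ : t ∸ suc k + suc k ≡ t
      t≡ = m∸n+n≡m k<t
      t∸k-1<l : t ∸ suc k < l
      t∸k-1<l = +-cancelʳ-< (suc k) (t ∸ suc k) l (subst (_< l + suc k) (sym t≡) t<l+k+1)
      t-shift : iter σ t u ≡ iter σ (t ∸ suc k) (iter σ (suc k) u)
      t-shift = trans (cong (λ j → iter σ j u) (sym t≡)) (iter-+ (t ∸ suc k) (suc k) u)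

  firstHit : ∀ {S : Fin n → Set} → Decidable S → ∀ {y z} → Reach σ y z → S z →
             ∃ λ t → S t × Seg σ S y t
  firstHit {S} S? {y} (k , refl) sz with leastWitness (λ j → S? (iter σ j y)) k sz
  ... | j , sj , before = iter σ j y , sj , j , refl , before

-- σ' = σ ∘ τ where τ moves only points of S.  Away from S both permutations
-- agree, so σ' walks along every σ-segment avoiding S.
module Twisted {n : ℕ} (σ σ' : Permutation′ n) (τ : Fin n → Fin n) (S : Fin n → Set)
               (σ'≡στ : ∀ y → σ' ⟨$⟩ʳ y ≡ σ ⟨$⟩ʳ τ y) (τ-fixes : ∀ y → ¬ S y → τ y ≡ y) where

  iter-agree : ∀ k u → (∀ {t} → t < k → ¬ S (iter σ t u)) → iter σ' k u ≡ iter σ k u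
  iter-agree zero    u avoid = refl
  iter-agree (suc k) u avoid =
    trans (σ'≡στ (iter σ' k u))
      (cong (σ ⟨$⟩ʳ_) (trans (cong τ (iter-agree k u (λ t<k → avoid (m<n⇒m<1+n t<k))))
                             (τ-fixes (iter σ k u) (avoid (n<1+n k)))))

  seg-lift : ∀ {u v} → Seg σ S u v → Reach σ' u v
  seg-lift {u} (k , e , avoid) = k , trans (iter-agree k u avoid) e

  twist-step : ∀ {s v} → τ s ≡ v → Reach σ' s (σ ⟨$⟩ʳ v)
  twist-step {s} e = 1 , trans (σ'≡στ s) (cong (σ ⟨$⟩ʳ_) e)

  -- If all of S σ'-reaches r, then so does every point whose σ-orbit meets S
  -- (walk along σ to the first point of S, then follow σ').
  reach-via : Decidable S → ∀ {r} → (∀ {s} → S s → Reach σ' s r) → ∀ {y z} → Reach σ y z → S z → Reach σ' y r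
  reach-via S? S→r y~z sz with Segments.firstHit σ S? y~z sz
  ... | t , st , y→t = Orbits.reach-trans σ' (seg-lift y→t) (S→r st)

oneOf? : ∀ {n} (xs : List (Fin n)) → Decidable (_∈ xs)
oneOf? xs y = Any.any? (y Fin.≟_) xs

-- a, b, c (resp. a, b, c, d) occur in this cyclic order on one cycle of σ:
-- from the successor of each point, σ leads to the next point without
-- meeting any of the others.
CyclicOrder3 : ∀ {n} → Permutation′ n → (a b c : Fin n) → Set
CyclicOrder3 σ a b c = Seg σ S (σ ⟨$⟩ʳ a) b × Seg σ S (σ ⟨$⟩ʳ b) c × Seg σ S (σ ⟨$⟩ʳ c) a
  where S = _∈ a ∷ b ∷ c ∷ []

CyclicOrder4 : ∀ {n} → Permutation′ n → (a b c d : Fin n) → Set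
CyclicOrder4 σ a b c d =
  Seg σ S (σ ⟨$⟩ʳ a) b × Seg σ S (σ ⟨$⟩ʳ b) c × Seg σ S (σ ⟨$⟩ʳ c) d × Seg σ S (σ ⟨$⟩ʳ d) a
  where S = _∈ a ∷ b ∷ c ∷ d ∷ []

module CyclicOrders {n : ℕ} (σ : Permutation′ n) where
  open Segments σ

  rotate3 : ∀ {a b c} → CyclicOrder3 σ a b c → CyclicOrder3 σ b c a
  rotate3 {a} {b} {c} (ab , bc , ca) = seg-weaken rot bc , seg-weaken rot ca , seg-weaken rot ab
    where
    rot : ∀ y → y ∈ b ∷ c ∷ a ∷ [] → y ∈ a ∷ b ∷ c ∷ []
    rot _ (here e)                 = there (here e)
    rot _ (there (here e))         = there (there (here e))
    rot _ (there (there (here e))) = here e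

  rotate4 : ∀ {a b c d} → CyclicOrder4 σ a b c d → CyclicOrder4 σ b c d a
  rotate4 {a} {b} {c} {d} (ab , bc , cd , da) =
    seg-weaken rot bc , seg-weaken rot cd , seg-weaken rot da , seg-weaken rot ab
    where
    rot : ∀ y → y ∈ b ∷ c ∷ d ∷ a ∷ [] → y ∈ a ∷ b ∷ c ∷ d ∷ []
    rot _ (here e)                         = there (here e)
    rot _ (there (here e))                 = there (there (here e))
    rot _ (there (there (here e)))         = there (there (there (here e)))
    rot _ (there (there (there (here e)))) = here e

  dropLast : ∀ {a b c d} → d ≢ a → d ≢ b → d ≢ c → CyclicOrder4 σ a b c d → CyclicOrder3 σ a b c
  dropLast {a} {b} {c} {d} d≢a d≢b d≢c (ab , bc , cd , da) =
    seg-weaken sub ab , seg-weaken sub bc , seg-join sub cd d∉abc da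
    where
    sub : ∀ y → y ∈ a ∷ b ∷ c ∷ [] → y ∈ a ∷ b ∷ c ∷ d ∷ []
    sub _ (here e)                 = here e
    sub _ (there (here e))         = there (here e)
    sub _ (there (there (here e))) = there (there (here e))
    d∉abc : d ∉ a ∷ b ∷ c ∷ []
    d∉abc (here e)                 = d≢a e
    d∉abc (there (here e))         = d≢b e
    d∉abc (there (there (here e))) = d≢c e

  dropFirst : ∀ {a b c d} → a ≢ b → a ≢ c → a ≢ d → CyclicOrder4 σ a b c d → CyclicOrder3 σ b c d
  dropFirst a≢b a≢c a≢d o = dropLast a≢b a≢c a≢d (rotate4 o)

  dropSecond : ∀ {a b c d} → b ≢ c → b ≢ d → b ≢ a → CyclicOrder4 σ a b c d → CyclicOrder3 σ a c d
  dropSecond b≢c b≢d b≢a o = rotate3 (rotate3 (dropLast b≢c b≢d b≢a (rotate4 (rotate4 o))))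

  dropThird : ∀ {a b c d} → c ≢ d → c ≢ a → c ≢ b → CyclicOrder4 σ a b c d → CyclicOrder3 σ a b d
  dropThird c≢d c≢a c≢b o = rotate3 (dropLast c≢d c≢a c≢b (rotate4 (rotate4 (rotate4 o))))

module OrbitOrder {n : ℕ} (σ : Permutation′ n) {u : Fin n} (p : Orbits.Period σ u) where
  open Orbits σ
  open Period p
  open Positions p

  pos : ℕ → Fin n
  pos q = iter σ q u

  interval : ∀ {lo hi} qs → lo ≤ hi → hi ≤ P → All (_< P) qs → All (λ q → q < lo ⊎ hi ≤ q) qs →
             Seg σ (_∈ map pos qs) (pos lo) (pos hi)
  interval {lo} {hi} qs lo≤hi hi≤P qs<P outside =
    hi ∸ lo , trans (sym (iter-+ (hi ∸ lo) lo u)) (cong pos (m∸n+n≡m lo≤hi)) , avoid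
    where
    avoid : ∀ {t} → t < hi ∸ lo → ¬ (iter σ t (pos lo) ∈ map pos qs)
    avoid {t} t<hi-lo hit with ∈-map⁻ pos hit
    ... | q , q∈qs , e = [ (λ q<lo → <⇒≱ q<lo (subst (lo ≤_) (sym q≡t+lo) (m≤n+m lo t)))
                         , (λ hi≤q → <⇒≱ t+lo<hi (subst (hi ≤_) q≡t+lo hi≤q)) ]′ (All.lookup outside q∈qs)
      where
      t+lo<hi : t + lo < hi
      t+lo<hi = subst (t + lo <_) (m∸n+n≡m lo≤hi) (+-monoˡ-< lo t<hi-lo)
      q≡t+lo : q ≡ t + lo
      q≡t+lo = position-injective (All.lookup qs<P q∈qs) (<-≤-trans t+lo<hi hi≤P)
                 (trans (sym e) (sym (iter-+ t lo u)))

  increasing⇒order : ∀ {q₁ q₂ q₃} → 0 < q₁ → q₁ < q₂ → q₂ < q₃ → q₃ < P →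
                     CyclicOrder4 σ u (pos q₁) (pos q₂) (pos q₃)
  increasing⇒order {q₁} {q₂} {q₃} 0<q₁ q₁<q₂ q₂<q₃ q₃<P =
    interval qs 0<q₁ (<⇒≤ q₁<P) qs<P (inj₁ z<s ∷ inj₂ ≤-refl ∷ inj₂ (<⇒≤ q₁<q₂) ∷ inj₂ (<⇒≤ q₁<q₃) ∷ []) ,
    interval qs q₁<q₂ (<⇒≤ q₂<P) qs<P (inj₁ z<s ∷ inj₁ ≤-refl ∷ inj₂ ≤-refl ∷ inj₂ (<⇒≤ q₂<q₃) ∷ []) ,
    interval qs q₂<q₃ (<⇒≤ q₃<P) qs<P (inj₁ z<s ∷ inj₁ (m<n⇒m<1+n q₁<q₂) ∷ inj₁ ≤-refl ∷ inj₂ ≤-refl ∷ []) ,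
    subst (Seg σ (_∈ map pos qs) (pos (suc q₃))) return
      (interval qs q₃<P ≤-refl qs<P (inj₁ z<s ∷ inj₁ (m<n⇒m<1+n q₁<q₃) ∷ inj₁ (m<n⇒m<1+n q₂<q₃) ∷ inj₁ ≤-refl ∷ []))
    where
    qs = 0 ∷ q₁ ∷ q₂ ∷ q₃ ∷ []
    q₁<q₃ = <-trans q₁<q₂ q₂<q₃
    q₂<P = <-trans q₂<q₃ q₃<P
    q₁<P = <-trans q₁<q₂ q₂<P
    qs<P : All (_< P) qs
    qs<P = P>0 ∷ q₁<P ∷ q₂<P ∷ q₃<P ∷ []

  Position : Fin n → Set
  Position v = ∃ λ q → 0 < q × q < P × pos q ≡ v

  position : ∀ {v} → Reach σ u v → u ≢ v → Position v
  position (k , refl) u≢v with reduce k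
  ... | zero    , _   , e = ⊥-elim (u≢v (sym e))
  ... | suc q , q<P , e = suc q , z<s , q<P , sym e

  Arrangements : Fin n → Fin n → Fin n → Set
  Arrangements b c d = CyclicOrder4 σ u b c d ⊎ CyclicOrder4 σ u d c b ⊎ CyclicOrder4 σ u b d c
                     ⊎ CyclicOrder4 σ u c b d ⊎ CyclicOrder4 σ u c d b ⊎ CyclicOrder4 σ u d b c

  arrangement : ∀ {b c d} → Position b → Position c → Position d → b ≢ c → b ≢ d → c ≢ d →
                Arrangements b c d
  arrangement (q₁ , 0<q₁ , q₁<P , refl) (q₂ , 0<q₂ , q₂<P , refl) (q₃ , 0<q₃ , q₃<P , refl) b≢c b≢d c≢d
    with <-cmp q₁ q₂ | <-cmp q₁ q₃ | <-cmp q₂ q₃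
  ... | tri≈ _ refl _ | _ | _ = ⊥-elim (b≢c refl)
  ... | _ | tri≈ _ refl _ | _ = ⊥-elim (b≢d refl)
  ... | _ | _ | tri≈ _ refl _ = ⊥-elim (c≢d refl)
  ... | tri< 1<2 _ _ | tri< 1<3 _ _ | tri< 2<3 _ _ = inj₁ (increasing⇒order 0<q₁ 1<2 2<3 q₃<P)
  ... | tri> _ _ 2<1 | tri> _ _ 3<1 | tri> _ _ 3<2 = inj₂ (inj₁ (increasing⇒order 0<q₃ 3<2 2<1 q₁<P))
  ... | tri< 1<2 _ _ | tri< 1<3 _ _ | tri> _ _ 3<2 = inj₂ (inj₂ (inj₁ (increasing⇒order 0<q₁ 1<3 3<2 q₂<P)))
  ... | tri> _ _ 2<1 | tri< 1<3 _ _ | tri< 2<3 _ _ = inj₂ (inj₂ (inj₂ (inj₁ (increasing⇒order 0<q₂ 2<1 1<3 q₃<P))))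
  ... | tri> _ _ 2<1 | tri> _ _ 3<1 | tri< 2<3 _ _ = inj₂ (inj₂ (inj₂ (inj₂ (inj₁ (increasing⇒order 0<q₂ 2<3 3<1 q₁<P)))))
  ... | tri< 1<2 _ _ | tri> _ _ 3<1 | tri> _ _ 3<2 = inj₂ (inj₂ (inj₂ (inj₂ (inj₂ (increasing⇒order 0<q₃ 3<1 1<2 q₂<P)))))
  ... | tri< 1<2 _ _ | tri> _ _ 3<1 | tri< 2<3 _ _ = ⊥-elim (<-asym (<-trans 1<2 2<3) 3<1)
  ... | tri> _ _ 2<1 | tri< 1<3 _ _ | tri> _ _ 3<2 = ⊥-elim (<-asym (<-trans 1<3 3<2) 2<1)

-- If every point of xs β'-reaches a fixed
-- r ∈ xs, then ν is again one cycle of β', and β' has the same cycles as β.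
module VertexTwist {n : ℕ} (β τ : Permutation′ n) (xs : List (Fin n)) {x r : Fin n}
    (τ-fixes : ∀ y → y ∉ xs → τ ⟨$⟩ʳ y ≡ y) (τ-closed : ∀ {y} → y ∈ xs → τ ⟨$⟩ʳ y ∈ xs)
    (xs⊆ν : All (Reach β x) xs) (r∈xs : r ∈ xs) (xs→r : ∀ {s} → s ∈ xs → Reach (τ ∘ₚ β) s r) where

  β' : Permutation′ n
  β' = τ ∘ₚ β

  open Twisted β β' (τ ⟨$⟩ʳ_) (_∈ xs) (λ _ → refl) τ-fixes
  module B  = Orbits β
  module B' = Orbits β'

  ν→r : ∀ {y} → Reach β x y → Reach β' y r
  ν→r x~y = reach-via (oneOf? xs) xs→r (B.reach-trans (B.reach-sym x~y) (All.lookup xs⊆ν r∈xs)) r∈xs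

  ν-cycle : ∀ {y} → Reach β x y → Reach β' x y
  ν-cycle x~y = B'.reach-trans (ν→r B.reach-refl) (B'.reach-sym (ν→r x~y))

  ν-closed : ∀ {y} → Reach β x y → Reach β x (β' ⟨$⟩ʳ y)
  ν-closed {y} x~y with oneOf? xs y
  ... | yes y∈xs = B.reach-trans (All.lookup xs⊆ν (τ-closed y∈xs)) B.reach-step
  ... | no  y∉xs = B.reach-trans x~y (subst (Reach β y) (cong (β ⟨$⟩ʳ_) (sym (τ-fixes y y∉xs))) B.reach-step)

  ν-closed* : ∀ k {y} → Reach β x y → Reach β x (iter β' k y)
  ν-closed* zero    x~y = x~y
  ν-closed* (suc k) x~y = ν-closed (ν-closed* k x~y)

  outside : ∀ {y} → ¬ Reach β x y → τ ⟨$⟩ʳ y ≡ y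
  outside x≁y = τ-fixes _ λ y∈xs → x≁y (All.lookup xs⊆ν y∈xs)

  outside* : ∀ {y} → ¬ Reach β x y → ∀ k → iter β' k y ≡ iter β k y
  outside* {y} x≁y k = iter-agree k y λ {t} _ hit → x≁y (B.reach-trans (All.lookup xs⊆ν hit) (B.reach-sym (t , refl)))

  same-orbits : ∀ {y z} → Reach β y z → Reach β' y z
  same-orbits {y} y~z with inOrbit? β x y
  ... | yes x~y = B'.reach-trans (ν→r (B.inOrbit⇒reach x~y))
                    (B'.reach-sym (ν→r (B.reach-trans (B.inOrbit⇒reach x~y) y~z)))
  ... | no  x≁y = proj₁ y~z , trans (outside* (x≁y ∘′ B.reach⇒inOrbit) (proj₁ y~z)) (proj₂ y~z)

  same-orbits⁻ : ∀ {y z} → Reach β' y z → Reach β y z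
  same-orbits⁻ {y} (k , refl) with inOrbit? β x y
  ... | yes x~y = B.reach-trans (B.reach-sym (B.inOrbit⇒reach x~y)) (ν-closed* k (B.inOrbit⇒reach x~y))
  ... | no  x≁y = k , sym (outside* (x≁y ∘′ B.reach⇒inOrbit) k)

  sameVertexCount : numCycles β ≡ numCycles β'
  sameVertexCount = numCycles-cong β β' same-orbits same-orbits⁻

  reembedding : Reembedding β x β'
  reembedding = (λ y x≁y → cong (β ⟨$⟩ʳ_) (outside (x≁y ∘′ B.reach⇒inOrbit)))
              , (λ y x~y → B.reach⇒inOrbit (ν-closed (B.inOrbit⇒reach x~y)))
              , (λ y x~y → B'.reach⇒inOrbit (ν-cycle (B.inOrbit⇒reach x~y)))

twist-transitive : ∀ {n} (σ σ' : Permutation′ n) (τ : Fin n → Fin n) (xs : List (Fin n)) {r} →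
                   (∀ y → σ' ⟨$⟩ʳ y ≡ σ ⟨$⟩ʳ τ y) → (∀ y → y ∉ xs → τ y ≡ y) → r ∈ xs →
                   (∀ {s} → s ∈ xs → Reach σ' s r) → (∀ u v → Reach σ u v) → ∀ u v → Reach σ' u v
twist-transitive σ σ' τ xs {r} σ'≡στ τ-fixes r∈xs xs→r σ-transitive u v =
  reach-trans (→r u) (reach-sym (→r v))
  where
  open Orbits σ'
  open Twisted σ σ' τ (_∈ xs) σ'≡στ τ-fixes
  →r : ∀ y → Reach σ' y r
  →r y = reach-via (oneOf? xs) xs→r (σ-transitive y r) r∈xs

hasGenus-cong : ∀ {n} (α β β' : Permutation′ n) → numCycles β ≡ numCycles β' →
                numCycles (faces α β) ≡ numCycles (faces α β') → ∀ g → HasGenus α β g ⇔ HasGenus α β' g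
hasGenus-cong α β β' sameV sameF g = mk⇔ (subst₂ equation sameV sameF) (subst₂ equation (sym sameV) (sym sameF))
  where
  equation : ℕ → ℕ → Set
  equation V F = + V ℤ.- + numCycles α ℤ.+ + F ≡ + 2 ℤ.- + (2 * g)

SameGenusReembedding : ∀ {n} → Permutation′ n → Permutation′ n → Fin n → Set
SameGenusReembedding {n} α β x = Σ (Permutation′ n) λ β' →
  Reembedding β x β' × (∃ λ y → β' ⟨$⟩ʳ y ≢ β ⟨$⟩ʳ y) × ((g : ℕ) → HasGenus α β g ⇔ HasGenus α β' g)

sameGenusTwist : ∀ {n} (α β τ : Permutation′ n) (xs : List (Fin n)) {x r : Fin n} →
                 numCycles (faces α β) ≡ 1 →
                 (∀ y → y ∉ xs → τ ⟨$⟩ʳ y ≡ y) → (∀ {y} → y ∈ xs → τ ⟨$⟩ʳ y ∈ xs) →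
                 All (Reach β x) xs → r ∈ xs → (∃ λ y → τ ⟨$⟩ʳ y ≢ y) →
                 (∀ {s} → s ∈ xs → Reach (τ ∘ₚ β) s r) → (∀ {s} → s ∈ xs → Reach (faces α (τ ∘ₚ β)) s r) →
                 SameGenusReembedding α β x
sameGenusTwist α β τ xs {x} oneFace τ-fixes τ-closed xs⊆ν r∈xs (y , τy≢y) vertex→r face→r =
  β' , reembedding , (y , τy≢y ∘′ Orbits.injective β) , hasGenus-cong α β β' sameVertexCount sameFaceCount
  where
  open VertexTwist β τ xs τ-fixes τ-closed xs⊆ν r∈xs vertex→r
  oneFace' : numCycles (faces α β') ≡ 1
  oneFace' = transitive⇒oneCycle (faces α β') x
    (twist-transitive (faces α β) (faces α β') (τ ⟨$⟩ʳ_) xs (λ _ → refl) τ-fixes r∈xs face→r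
      (CycleCount.oneCycle⇒transitive (faces α β) oneFace))
  sameFaceCount : numCycles (faces α β) ≡ numCycles (faces α β')
  sameFaceCount = trans oneFace (sym oneFace')

module _ {n : ℕ} where
  transpose-left : ∀ (i j : Fin n) → PC.transpose i j i ≡ j
  transpose-left i j with i Fin.≟ i
  ... | yes _  = refl
  ... | no i≢i = ⊥-elim (i≢i refl)

  transpose-right : ∀ (i j : Fin n) → PC.transpose i j j ≡ i
  transpose-right i j with j Fin.≟ i
  ... | yes refl = refl
  ... | no _ with j Fin.≟ j
  ...   | yes _  = refl
  ...   | no j≢j = ⊥-elim (j≢j refl)

  transpose-other : ∀ (i j k : Fin n) → k ≢ i → k ≢ j → PC.transpose i j k ≡ k
  transpose-other i j k k≢i k≢j with k Fin.≟ i
  ... | yes k≡i = ⊥-elim (k≢i k≡i)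
  ... | no _ with k Fin.≟ j
  ...   | yes k≡j = ⊥-elim (k≢j k≡j)
  ...   | no _    = refl

threeCycle-chain : ∀ {n} (σ σ' : Permutation′ n) (τ : Fin n → Fin n) {a b c : Fin n} →
                   (∀ y → σ' ⟨$⟩ʳ y ≡ σ ⟨$⟩ʳ τ y) → (∀ y → y ∉ a ∷ b ∷ c ∷ [] → τ y ≡ y) →
                   τ b ≡ c → τ c ≡ a → CyclicOrder3 σ a b c →
                   ∀ {s} → s ∈ a ∷ b ∷ c ∷ [] → Reach σ' s a
threeCycle-chain σ σ' τ {a} {b} {c} σ'≡στ τ-fixes τb≡c τc≡a (a⇝b , b⇝c , c⇝a) = chain
  where
  open Orbits σ'
  open Twisted σ σ' τ (_∈ a ∷ b ∷ c ∷ []) σ'≡στ τ-fixes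
  b→a : Reach σ' b a
  b→a = reach-trans (twist-step τb≡c) (seg-lift c⇝a)
  chain : ∀ {s} → s ∈ a ∷ b ∷ c ∷ [] → Reach σ' s a
  chain (here refl)                 = reach-refl
  chain (there (here refl))         = b→a
  chain (there (there (here refl))) = reach-trans (twist-step τc≡a) (reach-trans (seg-lift a⇝b) b→a)

doubleSwap-chain : ∀ {n} (σ σ' : Permutation′ n) (τ : Fin n → Fin n) {a b c d : Fin n} →
                   (∀ y → σ' ⟨$⟩ʳ y ≡ σ ⟨$⟩ʳ τ y) → (∀ y → y ∉ a ∷ b ∷ c ∷ d ∷ [] → τ y ≡ y) →
                   τ b ≡ d → τ c ≡ a → τ d ≡ b → CyclicOrder4 σ a b c d →
                   ∀ {s} → s ∈ a ∷ b ∷ c ∷ d ∷ [] → Reach σ' s a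
doubleSwap-chain σ σ' τ {a} {b} {c} {d} σ'≡στ τ-fixes τb≡d τc≡a τd≡b (a⇝b , b⇝c , c⇝d , d⇝a) = chain
  where
  open Orbits σ'
  open Twisted σ σ' τ (_∈ a ∷ b ∷ c ∷ d ∷ []) σ'≡στ τ-fixes
  b→a : Reach σ' b a
  b→a = reach-trans (twist-step τb≡d) (seg-lift d⇝a)
  c→a : Reach σ' c a
  c→a = reach-trans (twist-step τc≡a) (reach-trans (seg-lift a⇝b) b→a)
  chain : ∀ {s} → s ∈ a ∷ b ∷ c ∷ d ∷ [] → Reach σ' s a
  chain (here refl)                         = reach-refl
  chain (there (here refl))                 = b→a
  chain (there (there (here refl)))         = c→a
  chain (there (there (there (here refl)))) = reach-trans (twist-step τd≡b) (reach-trans (seg-lift b⇝c) c→a)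

record CommonTriple {n : ℕ} (β γ : Permutation′ n) (x : Fin n) : Set where
  field
    a b c         : Fin n
    a≢b           : a ≢ b
    a≢c           : a ≢ c
    b≢c           : b ≢ c
    at-vertex     : All (Reach β x) (a ∷ b ∷ c ∷ [])
    around-vertex : CyclicOrder3 β a b c
    along-face    : CyclicOrder3 γ a b c

record OppositeQuadruple {n : ℕ} (β γ : Permutation′ n) (x : Fin n) : Set where
  field
    a b c d       : Fin n
    a≢b           : a ≢ b
    a≢c           : a ≢ c
    a≢d           : a ≢ d
    b≢c           : b ≢ c
    b≢d           : b ≢ d
    c≢d           : c ≢ d
    at-vertex     : All (Reach β x) (a ∷ b ∷ c ∷ d ∷ [])
    around-vertex : CyclicOrder4 β a b c d
    along-face    : CyclicOrder4 γ a d c b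

commonTriple⇒sameGenus : ∀ {n} (α β : Permutation′ n) {x} → numCycles (faces α β) ≡ 1 →
                         CommonTriple β (faces α β) x → SameGenusReembedding α β x
commonTriple⇒sameGenus α β oneFace t =
  sameGenusTwist α β τ (a ∷ b ∷ c ∷ []) oneFace τ-fixes τ-closed at-vertex (here refl)
    (a , λ τa≡a → a≢b (trans (sym τa≡a) τa≡b))
    (threeCycle-chain β (τ ∘ₚ β) (τ ⟨$⟩ʳ_) (λ _ → refl) τ-fixes τb≡c τc≡a around-vertex)
    (threeCycle-chain (faces α β) (faces α (τ ∘ₚ β)) (τ ⟨$⟩ʳ_) (λ _ → refl) τ-fixes τb≡c τc≡a along-face)
  where
  open CommonTriple t
  τ = transpose b c ∘ₚ transpose a b
  τa≡b : τ ⟨$⟩ʳ a ≡ b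
  τa≡b = trans (cong (PC.transpose a b) (transpose-other b c a a≢b a≢c)) (transpose-left a b)
  τb≡c : τ ⟨$⟩ʳ b ≡ c
  τb≡c = trans (cong (PC.transpose a b) (transpose-left b c)) (transpose-other a b c (≢-sym a≢c) (≢-sym b≢c))
  τc≡a : τ ⟨$⟩ʳ c ≡ a
  τc≡a = trans (cong (PC.transpose a b) (transpose-right b c)) (transpose-right a b)
  τ-fixes : ∀ y → y ∉ a ∷ b ∷ c ∷ [] → τ ⟨$⟩ʳ y ≡ y
  τ-fixes y y∉abc = trans
    (cong (PC.transpose a b) (transpose-other b c y (y∉abc ∘′ there ∘′ here) (y∉abc ∘′ there ∘′ there ∘′ here)))
    (transpose-other a b y (y∉abc ∘′ here) (y∉abc ∘′ there ∘′ here))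
  τ-closed : ∀ {y} → y ∈ a ∷ b ∷ c ∷ [] → τ ⟨$⟩ʳ y ∈ a ∷ b ∷ c ∷ []
  τ-closed (here refl)                 = there (here τa≡b)
  τ-closed (there (here refl))         = there (there (here τb≡c))
  τ-closed (there (there (here refl))) = here τc≡a

oppositeQuadruple⇒sameGenus : ∀ {n} (α β : Permutation′ n) {x} → numCycles (faces α β) ≡ 1 →
                              OppositeQuadruple β (faces α β) x → SameGenusReembedding α β x
oppositeQuadruple⇒sameGenus α β oneFace q =
  sameGenusTwist α β τ (a ∷ b ∷ c ∷ d ∷ []) oneFace τ-fixes τ-closed at-vertex (here refl)
    (a , λ τa≡a → a≢c (trans (sym τa≡a) τa≡c))
    (doubleSwap-chain β (τ ∘ₚ β) (τ ⟨$⟩ʳ_) (λ _ → refl) τ-fixes τb≡d τc≡a τd≡b around-vertex)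
    (doubleSwap-chain (faces α β) (faces α (τ ∘ₚ β)) (τ ⟨$⟩ʳ_) (λ _ → refl)
       (λ y y∉adcb → τ-fixes y (y∉adcb ∘′ swap-bd)) τd≡b τc≡a τb≡d along-face ∘′ swap-bd)
  where
  open OppositeQuadruple q
  τ = transpose b d ∘ₚ transpose a c
  τa≡c : τ ⟨$⟩ʳ a ≡ c
  τa≡c = trans (cong (PC.transpose a c) (transpose-other b d a a≢b a≢d)) (transpose-left a c)
  τb≡d : τ ⟨$⟩ʳ b ≡ d
  τb≡d = trans (cong (PC.transpose a c) (transpose-left b d)) (transpose-other a c d (≢-sym a≢d) (≢-sym c≢d))
  τc≡a : τ ⟨$⟩ʳ c ≡ a
  τc≡a = trans (cong (PC.transpose a c) (transpose-other b d c (≢-sym b≢c) c≢d)) (transpose-right a c)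
  τd≡b : τ ⟨$⟩ʳ d ≡ b
  τd≡b = trans (cong (PC.transpose a c) (transpose-right b d)) (transpose-other a c b (≢-sym a≢b) b≢c)
  τ-fixes : ∀ y → y ∉ a ∷ b ∷ c ∷ d ∷ [] → τ ⟨$⟩ʳ y ≡ y
  τ-fixes y y∉abcd = trans
    (cong (PC.transpose a c) (transpose-other b d y (y∉abcd ∘′ there ∘′ here) (y∉abcd ∘′ there ∘′ there ∘′ there ∘′ here)))
    (transpose-other a c y (y∉abcd ∘′ here) (y∉abcd ∘′ there ∘′ there ∘′ here))
  τ-closed : ∀ {y} → y ∈ a ∷ b ∷ c ∷ d ∷ [] → τ ⟨$⟩ʳ y ∈ a ∷ b ∷ c ∷ d ∷ []
  τ-closed (here refl)                         = there (there (here τa≡c))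
  τ-closed (there (here refl))                 = there (there (there (here τb≡d)))
  τ-closed (there (there (here refl)))         = here τc≡a
  τ-closed (there (there (there (here refl)))) = there (here τd≡b)
  swap-bd : ∀ {y} → y ∈ a ∷ b ∷ c ∷ d ∷ [] → y ∈ a ∷ d ∷ c ∷ b ∷ []
  swap-bd (here e)                         = here e
  swap-bd (there (here e))                 = there (there (there (here e)))
  swap-bd (there (there (here e)))         = there (there (here e))
  swap-bd (there (there (there (here e)))) = there (here e)

configuration : ∀ {n} (β γ : Permutation′ n) (x : Fin n) → (∀ u v → Reach γ u v) → 4 ≤ deg β x →
                CommonTriple β γ x ⊎ OppositeQuadruple β γ x
configuration β γ x γ-transitive deg≥4 = classify (arrangement (face-position p₁≢x) (face-position p₂≢x) (face-position p₃≢x) p₁≢p₂ p₁≢p₃ p₂≢p₃)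
  where
  module V = OrbitOrder β (Orbits.period β x)
  module VP = Orbits.Positions β (Orbits.period β x)
  module F = OrbitOrder γ (Orbits.period γ x)
  open F using (arrangement)
  open CyclicOrders β renaming (dropFirst to vDropFirst; dropSecond to vDropSecond; dropThird to vDropThird; dropLast to vDropLast)
  open CyclicOrders γ renaming (dropFirst to fDropFirst; dropSecond to fDropSecond; dropLast to fDropLast; rotate3 to fRotate3)

  p₁ p₂ p₃ : _
  p₁ = iter β 1 x
  p₂ = iter β 2 x
  p₃ = iter β 3 x

  at : ∀ i → Reach β x (iter β i x)
  at i = i , refl

  3<P : 3 < Orbits.Period.P (Orbits.period β x)
  3<P = ≤-trans deg≥4 (deg≤period β x)

  distinct : ∀ {i j} → i ≤ 3 → j ≤ 3 → i ≢ j → iter β i x ≢ iter β j x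
  distinct i≤3 j≤3 i≢j e = i≢j (VP.position-injective (≤-<-trans i≤3 3<P) (≤-<-trans j≤3 3<P) e)

  p₁≢x : x ≢ p₁
  p₁≢x = distinct z≤n (s≤s z≤n) λ ()
  p₂≢x : x ≢ p₂
  p₂≢x = distinct z≤n (s≤s (s≤s z≤n)) λ ()
  p₃≢x : x ≢ p₃
  p₃≢x = distinct z≤n ≤-refl λ ()
  p₁≢p₂ : p₁ ≢ p₂
  p₁≢p₂ = distinct (s≤s z≤n) (s≤s (s≤s z≤n)) λ ()
  p₁≢p₃ : p₁ ≢ p₃
  p₁≢p₃ = distinct (s≤s z≤n) ≤-refl λ ()
  p₂≢p₃ : p₂ ≢ p₃
  p₂≢p₃ = distinct (s≤s (s≤s z≤n)) ≤-refl λ ()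

  face-position : ∀ {v} → x ≢ v → F.Position v
  face-position x≢v = F.position (γ-transitive x _) x≢v

  around-vertex : CyclicOrder4 β x p₁ p₂ p₃
  around-vertex = V.increasing⇒order z<s (n<1+n 1) (n<1+n 2) 3<P

  triple : ∀ {i j k} → iter β i x ≢ iter β j x → iter β i x ≢ iter β k x → iter β j x ≢ iter β k x →
           CyclicOrder3 β (iter β i x) (iter β j x) (iter β k x) → CyclicOrder3 γ (iter β i x) (iter β j x) (iter β k x) →
           CommonTriple β γ x ⊎ OppositeQuadruple β γ x
  triple {i} {j} {k} a≢b a≢c b≢c vertex face = inj₁ record
    { a≢b = a≢b ; a≢c = a≢c ; b≢c = b≢c ; at-vertex = at i ∷ at j ∷ at k ∷ []
    ; around-vertex = vertex ; along-face = face }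

  classify : F.Arrangements p₁ p₂ p₃ → CommonTriple β γ x ⊎ OppositeQuadruple β γ x
  classify (inj₁ face) =
    triple {0} {1} {2} p₁≢x p₂≢x p₁≢p₂
      (vDropLast (≢-sym p₃≢x) (≢-sym p₁≢p₃) (≢-sym p₂≢p₃) around-vertex)
      (fDropLast (≢-sym p₃≢x) (≢-sym p₁≢p₃) (≢-sym p₂≢p₃) face)
  classify (inj₂ (inj₁ face)) = inj₂ record
    { a≢b = p₁≢x ; a≢c = p₂≢x ; a≢d = p₃≢x ; b≢c = p₁≢p₂ ; b≢d = p₁≢p₃ ; c≢d = p₂≢p₃
    ; at-vertex = at 0 ∷ at 1 ∷ at 2 ∷ at 3 ∷ [] ; around-vertex = around-vertex ; along-face = face }
  classify (inj₂ (inj₂ (inj₁ face))) =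
    triple {0} {1} {3} p₁≢x p₃≢x p₁≢p₃
      (vDropThird p₂≢p₃ (≢-sym p₂≢x) (≢-sym p₁≢p₂) around-vertex)
      (fDropLast (≢-sym p₂≢x) (≢-sym p₁≢p₂) p₂≢p₃ face)
  classify (inj₂ (inj₂ (inj₂ (inj₁ face)))) =
    triple {0} {1} {3} p₁≢x p₃≢x p₁≢p₃
      (vDropThird p₂≢p₃ (≢-sym p₂≢x) (≢-sym p₁≢p₂) around-vertex)
      (fDropSecond (≢-sym p₁≢p₂) p₂≢p₃ (≢-sym p₂≢x) face)
  classify (inj₂ (inj₂ (inj₂ (inj₂ (inj₁ face))))) =
    triple {0} {2} {3} p₂≢x p₃≢x p₂≢p₃
      (vDropSecond p₁≢p₂ p₁≢p₃ (≢-sym p₁≢x) around-vertex)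
      (fDropLast (≢-sym p₁≢x) p₁≢p₂ p₁≢p₃ face)
  classify (inj₂ (inj₂ (inj₂ (inj₂ (inj₂ face))))) =
    triple {1} {2} {3} p₁≢p₂ p₁≢p₃ p₂≢p₃
      (vDropFirst p₁≢x p₂≢x p₃≢x around-vertex)
      (fRotate3 (fDropFirst p₃≢x p₁≢x p₂≢x face))

theorem3p2 : (m : ℕ) (α β : Permutation′ (2 * m)) →
    FPFInvolution α →
    numCycles (faces α β) ≡ 1 →
    (x : Fin (2 * m)) → 4 ≤ deg β x →
    Σ (Permutation′ (2 * m)) λ β' →
      Reembedding β x β' ×
      (∃ λ y → β' ⟨$⟩ʳ y ≢ β ⟨$⟩ʳ y) ×
      ((g : ℕ) → HasGenus α β g ⇔ HasGenus α β' g)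
theorem3p2 m α β _ oneFace x deg≥4 =
  [ commonTriple⇒sameGenus α β oneFace , oppositeQuadruple⇒sameGenus α β oneFace ]′
    (configuration β (faces α β) x (CycleCount.oneCycle⇒transitive (faces α β) oneFace) deg≥4)
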